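{- The permutation class $Av(\mathbf{4123},\mathbf{1243},\mathbf{1423})$ equals the generalized grid class $\mathbb{G}$ consisting of two cells stacked vertically, the top cell being $Av(\mathbf{21})$ and the bottom cell being $Av(\mathbf{123})$. That is, a permutation $\sigma$ of $\{1,\dots,n\}$ avoids $\mathbf{4123}$, $\mathbf{1243}$ and $\mathbf{1423}$ if and only if there exists $k\in\{0,1,\dots,n\}$ such that the subsequence of $\sigma$ formed by the entries with values in $\{k+1,\dots,n\}$ is increasing (avoids $\mathbf{21}$) and the subsequence formed by the entries with values in $\{1,\dots,k\}$ avoids $\mathbf{123}$.
   Context: A permutation $\sigma$ contains a pattern $\pi$ if some subsequence of $\sigma$ is order-isomorphic to $\pi$; otherwise $\sigma$ avoids $\pi$. For a set $B$ of patterns, $Av(B)$ is the set of permutations avoiding every element of $B$. -}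

module Defs where

open import Data.Nat using (ℕ; _≤_)
open import Data.Fin using (Fin; toℕ; _<_; zero; suc)
open import Data.Product using (Σ; _×_; ∃)
open import Function.Bundles using (_↔_; _⇔_)
open import Function.Bundles using (module Inverse)
open import Relation.Nullary using (¬_)

-- A permutation of length n: a bijection on Fin n (positions ↦ values, 0-based).
Perm : ℕ → Set
Perm n = Fin n ↔ Fin n

Pattern : ℕ → Set
Pattern k = Fin k → Fin k

StrictlyIncreasing : ∀ {k n} → (Fin k → Fin n) → Set
StrictlyIncreasing f = ∀ i j → i < j → f i < f j

OccursIn : ∀ {k n} → Pattern k → (Fin n → Fin n) → (Fin n → Set) → Set
OccursIn {k} {n} π w P =
  Σ (Fin k → Fin n) λ f →
    StrictlyIncreasing f ×
    (∀ i → P (w (f i))) ×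
    (∀ i j → (π i < π j) ⇔ (w (f i) < w (f j)))

Contains : ∀ {n k} → Perm n → Pattern k → Set
Contains σ π = OccursIn π (Inverse.to σ) (λ _ → Data.Unit.⊤)
  where import Data.Unit

Avoids : ∀ {n k} → Perm n → Pattern k → Set
Avoids σ π = ¬ Contains σ π

-- Patterns (0-based one-line notation).
-- 4123
p4123 : Pattern 4
p4123 zero = suc (suc (suc zero))
p4123 (suc zero) = zero
p4123 (suc (suc zero)) = suc zero
p4123 (suc (suc (suc zero))) = suc (suc zero)

p1243 : Pattern 4
p1243 zero = zero
p1243 (suc zero) = suc zero
p1243 (suc (suc zero)) = suc (suc (suc zero))
p1243 (suc (suc (suc zero))) = suc (suc zero)

p1423 : Pattern 4
p1423 zero = zero
p1423 (suc zero) = suc (suc (suc zero))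
p1423 (suc (suc zero)) = suc zero
p1423 (suc (suc (suc zero))) = suc (suc zero)

p21 : Pattern 2
p21 zero = suc zero
p21 (suc zero) = zero

p123 : Pattern 3
p123 zero = zero
p123 (suc zero) = suc zero
p123 (suc (suc zero)) = suc (suc zero)

-- The generalized grid class: two cells stacked vertically, top Av(21), bottom Av(123).
-- σ is in it iff for some k ∈ {0..n}, the subsequence of entries with (1-based)
-- values in {k+1..n} (0-based value v with k ≤ v) avoids 21, and the subsequence
-- of entries with values in {1..k} (0-based v < k) avoids 123.
InGrid : ∀ {n} → Perm n → Set
InGrid {n} σ = Σ ℕ λ k → (k ≤ n) ×
  (¬ OccursIn p21 (Inverse.to σ) (λ v → k ≤ toℕ v)) ×
  (¬ OccursIn p123 (Inverse.to σ) (λ v → toℕ v Data.Nat.< k))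

-- Call an entry a descent bottom if some larger entry lies to its left.  If σ avoids
-- 4123, 1243 and 1423, then no descent bottom is the top of a 123: the larger entry
-- on its left would complete one of the three patterns, according to where it sits.
-- More generally no descent bottom lies above the top of a 123.  So cutting σ just
-- above its largest descent bottom leaves no descent above the cut and no 123
-- below it.  Conversely, in each of the three patterns the last entry is the bottom
-- of a 21 among the entries above it and the top of a 123 among those below it,
-- so whichever cell receives the last entry contains the forbidden pattern.
module Submission where

open import Defs
open import Data.Nat as ℕ using (ℕ; zero; suc; z≤n; z<s; s<s)
import Data.Nat.Properties as ℕ
open import Data.Fin using (Fin; suc; toℕ; inject₁; _<_; _≤_)
open import Data.Fin.Patterns using (0F; 1F; 2F; 3F)
open import Data.Fin.Properties using (_≟_; _<?_; _≤?_; <-cmp; <-trans; <-asym; <-irrefl; ≤∧≢⇒<; <⇒≢; all?; any?; toℕ<n)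
open import Data.Vec.Functional using ([]; _∷_)
open import Data.Product using (Σ; ∃; _×_; _,_)
open import Data.Sum using (_⊎_; inj₁; inj₂)
open import Data.Unit using (⊤; tt)
open import Data.Empty using (⊥-elim)
open import Function using (_∘_)
open import Function.Bundles using (_⇔_; mk⇔; Equivalence; Inverse; Injection)
open import Function.Properties.Equivalence using () renaming (trans to ⇔-trans)
open import Function.Properties.Inverse using (↔⇒↣)
open import Relation.Nullary using (¬_; Dec; yes; no)
open import Relation.Nullary.Decidable using (True; toWitness; _×-dec_)
open import Relation.Unary using (Decidable)
open import Relation.Binary using (tri<; tri≈; tri>)
open import Relation.Binary.PropositionalEquality using (_≡_; refl; cong; sym; trans; subst₂)

Chain : ∀ {k n} → (Fin (suc k) → Fin n) → Set
Chain f = ∀ i → f (inject₁ i) < f (suc i)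

chain? : ∀ {k n} (f : Fin (suc k) → Fin n) → Dec (Chain f)
chain? f = all? λ i → f (inject₁ i) <? f (suc i)

chain₄ : ∀ {n} (g : Fin 4 → Fin n) → g 0F < g 1F → g 1F < g 2F → g 2F < g 3F → Chain g
chain₄ g g₀<g₁ g₁<g₂ g₂<g₃ 0F = g₀<g₁
chain₄ g g₀<g₁ g₁<g₂ g₂<g₃ 1F = g₁<g₂
chain₄ g g₀<g₁ g₁<g₂ g₂<g₃ 2F = g₂<g₃

chain⇒strictlyIncreasing : ∀ {k n} (f : Fin (suc k) → Fin n) → Chain f → StrictlyIncreasing f
chain⇒strictlyIncreasing {suc k} f c 0F 1F _ = c 0F
chain⇒strictlyIncreasing {suc k} f c 0F (suc (suc j)) _ =
  <-trans (c 0F) (chain⇒strictlyIncreasing (f ∘ suc) (c ∘ suc) 0F (suc j) z<s)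
chain⇒strictlyIncreasing {suc k} f c (suc i) (suc j) (s<s i<j) =
  chain⇒strictlyIncreasing (f ∘ suc) (c ∘ suc) i j i<j

-- ρ lists the positions of π in increasing order of value, so an occurrence is
-- given by positions and values that both increase along a chain.
occursIn-byRanks : ∀ {k n} (π ρ : Pattern (suc k)) → (∀ i → ρ (π i) ≡ i) →
  {w : Fin n → Fin n} {P : Fin n → Set} (f : Fin (suc k) → Fin n) →
  Chain f → Chain (w ∘ f ∘ ρ) → (∀ i → P (w (f i))) → OccursIn π w P
occursIn-byRanks π ρ ρ∘π {w} f positions values inP =
  f , chain⇒strictlyIncreasing f positions , inP , λ i j → mk⇔ (preserves i j) (reflects i j)
  where
  preserves : ∀ i j → π i < π j → w (f i) < w (f j)
  preserves i j πi<πj = subst₂ (λ a b → w (f a) < w (f b)) (ρ∘π i) (ρ∘π j)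
    (chain⇒strictlyIncreasing (w ∘ f ∘ ρ) values (π i) (π j) πi<πj)

  reflects : ∀ i j → w (f i) < w (f j) → π i < π j
  reflects i j lt with <-cmp (π i) (π j)
  ... | tri< πi<πj _ _ = πi<πj
  ... | tri≈ _ πi≡πj _ = ⊥-elim (<-irrefl (cong (w ∘ f) i≡j) lt)
    where
    i≡j : i ≡ j
    i≡j = trans (sym (ρ∘π i)) (trans (cong ρ πi≡πj) (ρ∘π j))
  ... | tri> _ _ πj<πi = ⊥-elim (<-asym lt (preserves j i πj<πi))

occursIn-byComputation : ∀ {k n} (π ρ : Pattern (suc k)) (w : Fin n → Fin n)
  {P : Fin n → Set} (P? : Decidable P) (f : Fin (suc k) → Fin n) →
  {True (all? (λ i → ρ (π i) ≟ i) ×-dec chain? f ×-dec chain? (w ∘ f ∘ ρ) ×-dec all? (λ i → P? (w (f i))))} →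
  OccursIn π w P
occursIn-byComputation π ρ w {P} P? f {ok} with toWitness ok
... | ρ∘π , positions , values , inP = occursIn-byRanks π ρ ρ∘π {w} {P} f positions values inP

occursIn-∘ : ∀ {j l n} {τ : Pattern j} {π : Pattern l} {w : Fin n → Fin n}
  {Q P : Fin n → Set} {R : Fin l → Set} →
  ((f , _) : OccursIn π w Q) → OccursIn τ π R → (∀ i → R (π i) → P (w (f i))) → OccursIn τ w P
occursIn-∘ (f , f↑ , _ , f≅) (g , g↑ , inR , g≅) R⇒P =
  f ∘ g ,
  (λ i j i<j → f↑ (g i) (g j) (g↑ i j i<j)) ,
  (λ i → R⇒P (g i) (inR i)) ,
  (λ i j → ⇔-trans (g≅ i j) (f≅ (g i) (g j)))

occurrence-monotone : ∀ {l n} {π : Pattern l} {w : Fin n → Fin n} {f : Fin l → Fin n} →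
  (∀ i j → (π i < π j) ⇔ (w (f i) < w (f j))) → ∀ i j → π i ≤ π j → w (f i) ≤ w (f j)
occurrence-monotone f≅ i j πi≤πj = ℕ.≮⇒≥ λ lt → ℕ.<⇒≱ (Equivalence.from (f≅ j i) lt) πi≤πj

module GridCells {n} (w : Fin n → Fin n) (k : ℕ) where

  Top : Fin n → Set
  Top v = k ℕ.≤ toℕ v

  Bottom : Fin n → Set
  Bottom v = toℕ v ℕ.< k

  gridAvoids : ∀ {i j l} {τ : Pattern i} {υ : Pattern j} (π : Pattern l) (m : Fin l) →
    OccursIn τ π (π m ≤_) → OccursIn υ π (_≤ π m) →
    ¬ OccursIn τ w Top → ¬ OccursIn υ w Bottom → ¬ OccursIn π w (λ _ → ⊤)
  gridAvoids π m τ-above υ-below τ-free υ-free occ@(f , _ , _ , f≅) with k ℕ.≤? toℕ (w (f m))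
  ... | yes top = τ-free (occursIn-∘ {w = w} {P = Top} {R = π m ≤_} occ τ-above λ i πm≤πi →
          ℕ.≤-trans top (occurrence-monotone {w = w} {f = f} f≅ m i πm≤πi))
  ... | no ¬top = υ-free (occursIn-∘ {w = w} {P = Bottom} {R = _≤ π m} occ υ-below λ i πi≤πm →
          ℕ.≤-<-trans (occurrence-monotone {w = w} {f = f} f≅ i m πi≤πm) (ℕ.≰⇒> ¬top))

argmax : ∀ {n} {R : Fin n → Set} → Decidable R → (v : Fin n → ℕ) →
  (∀ q → ¬ R q) ⊎ ∃ λ q₀ → R q₀ × (∀ q → R q → v q ℕ.≤ v q₀)
argmax {zero} R? v = inj₁ λ ()
argmax {suc n} R? v with argmax (R? ∘ suc) (v ∘ suc) | R? 0F
... | inj₁ none | no ¬r₀ = inj₁ λ { 0F → ¬r₀ ; (suc q) → none q }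
... | inj₁ none | yes r₀ = inj₂ (0F , r₀ , λ { 0F _ → ℕ.≤-refl ; (suc q) r → ⊥-elim (none q r) })
... | inj₂ (q₀ , r , max) | no ¬r₀ = inj₂ (suc q₀ , r , λ { 0F r₀ → ⊥-elim (¬r₀ r₀) ; (suc q) r′ → max q r′ })
... | inj₂ (q₀ , r , max) | yes r₀ with v 0F ℕ.≤? v (suc q₀)
...   | yes le = inj₂ (suc q₀ , r , λ { 0F _ → le ; (suc q) r′ → max q r′ })
...   | no gt  = inj₂ (0F , r₀ , λ { 0F _ → ℕ.≤-refl
                                 ; (suc q) r′ → ℕ.≤-trans (max q r′) (ℕ.<⇒≤ (ℕ.≰⇒> gt)) })

module Avoiding {n} (w : Fin n → Fin n) (w-injective : ∀ {a b} → w a ≡ w b → a ≡ b)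
  (avoids4123 : ¬ OccursIn p4123 w (λ _ → ⊤))
  (avoids1243 : ¬ OccursIn p1243 w (λ _ → ⊤))
  (avoids1423 : ¬ OccursIn p1423 w (λ _ → ⊤)) where

  DescentBottom : Fin n → Set
  DescentBottom q = ∃ λ p → p < q × w q < w p

  descentBottom? : Decidable DescentBottom
  descentBottom? q = any? λ p → (p <? q) ×-dec (w q <? w p)

  occursAt₄ : (π ρ : Pattern 4) → {True (all? λ i → ρ (π i) ≟ i)} → {a b c d : Fin n} →
    a < b → b < c → c < d →
    let g = w ∘ (a ∷ b ∷ c ∷ d ∷ []) ∘ ρ in g 0F < g 1F → g 1F < g 2F → g 2F < g 3F →
    OccursIn π w (λ _ → ⊤)
  occursAt₄ π ρ {ranked} {a} {b} {c} {d} ab bc cd v₁ v₂ v₃ =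
    occursIn-byRanks π ρ (toWitness ranked) {w} f (chain₄ f ab bc cd) (chain₄ (w ∘ f ∘ ρ) v₁ v₂ v₃) (λ _ → tt)
    where
    f : Fin 4 → Fin n
    f = a ∷ b ∷ c ∷ d ∷ []

  4123-at : ∀ {a b c d} → a < b → b < c → c < d → w b < w c → w c < w d → w d < w a →
    OccursIn p4123 w (λ _ → ⊤)
  4123-at = occursAt₄ p4123 (1F ∷ 2F ∷ 3F ∷ 0F ∷ [])

  1243-at : ∀ {a b c d} → a < b → b < c → c < d → w a < w b → w b < w d → w d < w c →
    OccursIn p1243 w (λ _ → ⊤)
  1243-at = occursAt₄ p1243 (0F ∷ 1F ∷ 3F ∷ 2F ∷ [])

  1423-at : ∀ {a b c d} → a < b → b < c → c < d → w a < w c → w c < w d → w d < w b →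
    OccursIn p1423 w (λ _ → ⊤)
  1423-at = occursAt₄ p1423 (0F ∷ 2F ∷ 3F ∷ 1F ∷ [])

  123-top-¬descentBottom : ∀ {x y q} → x < y → y < q → w x < w y → w y < w q → ¬ DescentBottom q
  123-top-¬descentBottom {x} {y} xy yq vxy vyq (h , hq , vqh) with <-cmp h x
  ... | tri< hx _ _ = avoids4123 (4123-at hx xy yq vxy vyq vqh)
  ... | tri≈ _ refl _ = <-asym vqh (<-trans vxy vyq)
  ... | tri> _ _ xh with <-cmp h y
  ...   | tri< hy _ _ = avoids1423 (1423-at xh hy yq vxy vyq vqh)
  ...   | tri≈ _ refl _ = <-asym vqh vyq
  ...   | tri> _ _ yh = avoids1243 (1243-at xy yh hq vxy vyq vqh)

  123-¬largerBeforeMiddle : ∀ {x y z q} → x < y → y < z → w x < w y → w y < w z →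
    q < y → ¬ w z < w q
  123-¬largerBeforeMiddle {x} {q = q} xy yz vxy vyz qy vz<vq with <-cmp q x
  ... | tri< qx _ _ = avoids4123 (4123-at qx xy yz vxy vyz vz<vq)
  ... | tri≈ _ refl _ = <-asym vz<vq (<-trans vxy vyz)
  ... | tri> _ _ xq = avoids1423 (1423-at xq qy yz vxy vyz vz<vq)

  above-123-¬descentBottom : ∀ {x y z q} → x < y → y < z → w x < w y → w y < w z → w z ≤ w q →
    ¬ DescentBottom q
  above-123-¬descentBottom {y = y} {q = q} xy yz vxy vyz vz≤vq descent with <-cmp q y
  ... | tri> _ _ yq = 123-top-¬descentBottom xy yq vxy (ℕ.<-≤-trans vyz vz≤vq) descent
  ... | tri≈ _ refl _ = ℕ.<⇒≱ vyz vz≤vq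
  ... | tri< qy _ _ = 123-¬largerBeforeMiddle xy yz vxy vyz qy
        (≤∧≢⇒< vz≤vq λ vz≡vq → <⇒≢ (<-trans qy yz) (sym (w-injective vz≡vq)))

  open GridCells w

  21-end-descentBottom : ∀ {k} → OccursIn p21 w (Top k) → ∃ λ q → Top k (w q) × DescentBottom q
  21-end-descentBottom (f , f↑ , inTop , f≅) =
    f 1F , inTop 1F , f 0F , f↑ 0F 1F z<s , Equivalence.to (f≅ 1F 0F) z<s

  -- k is one more than the largest value of a descent bottom, or 0 if there is none.
  inGrid : Σ ℕ λ k → k ℕ.≤ n × ¬ OccursIn p21 w (Top k) × ¬ OccursIn p123 w (Bottom k)
  inGrid with argmax descentBottom? (toℕ ∘ w)
  ... | inj₁ none = 0 , z≤n , (λ occ → let (q , _ , d) = 21-end-descentBottom occ in none q d) ,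
                    λ (_ , _ , inBottom , _) → ℕ.n≮0 (inBottom 0F)
  ... | inj₂ (q₀ , d₀ , max) = suc (toℕ (w q₀)) , toℕ<n (w q₀) ,
        (λ occ → let (q , top , d) = 21-end-descentBottom occ in ℕ.<⇒≱ top (max q d)) ,
        λ (f , f↑ , inBottom , f≅) → above-123-¬descentBottom
          (f↑ 0F 1F z<s) (f↑ 1F 2F (s<s z<s))
          (Equivalence.to (f≅ 0F 1F) z<s) (Equivalence.to (f≅ 1F 2F) (s<s z<s))
          (ℕ.≤-pred (inBottom 2F)) d₀

lemma3p2 : (n : ℕ) (σ : Perm n) →
    (Avoids σ p4123 × Avoids σ p1243 × Avoids σ p1423) ⇔ InGrid σ
lemma3p2 n σ = mk⇔ avoids⇒grid grid⇒avoids
  where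
  w : Fin n → Fin n
  w = Inverse.to σ

  avoids⇒grid : Avoids σ p4123 × Avoids σ p1243 × Avoids σ p1423 → InGrid σ
  avoids⇒grid (a₁ , a₂ , a₃) = Avoiding.inGrid w (Injection.injective (↔⇒↣ σ)) a₁ a₂ a₃

  grid⇒avoids : InGrid σ → Avoids σ p4123 × Avoids σ p1243 × Avoids σ p1423
  grid⇒avoids (k , _ , top , bottom) =
    gridAvoids p4123 3F (occursIn-byComputation p21 ρ₂₁ p4123 (p4123 3F ≤?_) (0F ∷ 3F ∷ []))
                        (occursIn-byComputation p123 ρ₁₂₃ p4123 (_≤? p4123 3F) (1F ∷ 2F ∷ 3F ∷ [])) top bottom ,
    gridAvoids p1243 3F (occursIn-byComputation p21 ρ₂₁ p1243 (p1243 3F ≤?_) (2F ∷ 3F ∷ []))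
                        (occursIn-byComputation p123 ρ₁₂₃ p1243 (_≤? p1243 3F) (0F ∷ 1F ∷ 3F ∷ [])) top bottom ,
    gridAvoids p1423 3F (occursIn-byComputation p21 ρ₂₁ p1423 (p1423 3F ≤?_) (1F ∷ 3F ∷ []))
                        (occursIn-byComputation p123 ρ₁₂₃ p1423 (_≤? p1423 3F) (0F ∷ 2F ∷ 3F ∷ [])) top bottom
    where
    open GridCells w k
    ρ₂₁ : Pattern 2
    ρ₂₁ = 1F ∷ 0F ∷ []
    ρ₁₂₃ : Pattern 3
    ρ₁₂₃ = 0F ∷ 1F ∷ 2F ∷ []
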